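{- Let $G$ be a graph, $L$ a list assignment on the vertices of the total graph $\mathcal{T}(G)$, $\gamma$ a partial $L$-coloring of $\mathcal{T}(G)$, and $S$ a clique of $\mathcal{T}(G)$ all of whose elements are colored by $\gamma$. Assume that the color shifting graph $H_{S,\gamma}$ contains a directed cycle $x_1\to x_2\to\cdots\to x_n\to x_1$. Then there exists a partial $L$-coloring $\gamma'$ of $\mathcal{T}(G)$, defined on exactly the same elements as $\gamma$, such that $\gamma'(x)\neq\gamma(x)$ for every $x\in S\cap\{x_1,\ldots,x_n\}$ and $\gamma'(x)=\gamma(x)$ for every other element $x$ on which $\gamma$ is defined.
   Context: The total graph $\mathcal{T}(G)$ has vertex set $V(G)\cup E(G)$, two elements being adjacent if they are adjacent vertices of $G$, or incident vertex and edge, or two edges sharing an endpoint. A list assignment $L$ gives each vertex $x$ of $\mathcal{T}(G)$ a set $L(x)$ of colors; a partial $L$-coloring is a map $\gamma$ defined on a subset of $V(\mathcal{T}(G))$ with $\gamma(x)\in L(x)$ and $\gamma(x)\neq\gamma(y)$ whenever $x,y$ are adjacent and both colored. For $x\in S$, let $\hat{x}$ be the set of colors of $L(x)$ not equal to $\gamma(y)$ for any colored neighbor $y\notin S$ of $x$ in $\mathcal{T}(G)$ (the colors available for $x$ once $S$ is uncolored). The color shifting graph $H_{S,\gamma}$ is the loopless digraph whose vertices are the elements of $S$ together with a new vertex $s_\alpha$ for each color $\alpha\in\bigcup_{x\in S}\hat{x}$, with arcs: $x\to y$ for distinct $x,y\in S$ whenever $\gamma(x)\in\hat{y}$; $s_\alpha\to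 x$ for $x\in S$ whenever $\alpha\in\hat{x}$ and $\alpha\notin\gamma(S)$; $x\to s_\alpha$ for every $x\in S$ and every $\alpha$; and $s_\alpha\to s_\beta$ for all $\alpha\neq\beta$. -}

module Defs where

open import Data.Nat using (ℕ)
open import Data.Fin using (Fin; _<_)
open import Data.Bool using (Bool; true)
open import Data.Maybe using (Maybe; just; nothing)
open import Data.Sum using (_⊎_; inj₁; inj₂)
open import Data.Product using (Σ; _×_; _,_; proj₁; ∃; ∃-syntax)
open import Data.List using (List; []; _∷_; _∷ʳ_)
open import Data.List.Membership.Propositional using (_∈_)
open import Data.List.Relation.Unary.Linked using (Linked)
open import Data.List.Relation.Unary.Unique.Propositional using (Unique)
open import Relation.Binary.PropositionalEquality using (_≡_; _≢_)
open import Relation.Nullary using (¬_)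
open import Data.Empty using (⊥)

record Graph : Set where
  field
    n     : ℕ
    adj   : Fin n → Fin n → Bool
    sym   : ∀ u v → adj u v ≡ adj v u
    irrfl : ∀ u → ¬ (adj u u ≡ true)

module _ (G : Graph) where
  open Graph G

  Edge : Set
  Edge = Σ (Fin n × Fin n) λ p → (proj₁ p < Data.Product.proj₂ p) × adj (proj₁ p) (Data.Product.proj₂ p) ≡ true

  end₁ end₂ : Edge → Fin n
  end₁ ((u , v) , _) = u
  end₂ ((u , v) , _) = v

  TElem : Set
  TElem = Fin n ⊎ Edge

  Incident : Fin n → Edge → Set
  Incident u e = (u ≡ end₁ e) ⊎ (u ≡ end₂ e)

  TAdj : TElem → TElem → Set
  TAdj (inj₁ u) (inj₁ v) = adj u v ≡ true
  TAdj (inj₁ u) (inj₂ e) = Incident u e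
  TAdj (inj₂ e) (inj₁ u) = Incident u e
  TAdj (inj₂ e) (inj₂ f) = (e ≢ f) × ∃[ w ] (Incident w e × Incident w f)

  module _ {C : Set} where

    ListAssignment : Set₁
    ListAssignment = TElem → C → Set

    PartialColoring : Set
    PartialColoring = TElem → Maybe C

    IsPartialLColoring : ListAssignment → PartialColoring → Set
    IsPartialLColoring L γ =
      (∀ x c → γ x ≡ just c → L x c) ×
      (∀ x y c → TAdj x y → γ x ≡ just c → γ y ≢ just c)

    module _ (L : ListAssignment) (γ : PartialColoring) (S : TElem → Set) where

      hat : TElem → C → Set
      hat x α = L x α × (∀ y → TAdj x y → ¬ S y → γ y ≢ just α)

      InHatUnion : C → Set
      InHatUnion α = ∃[ x ] (S x × hat x α)

      NotUsedOnS : C → Set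
      NotUsedOnS α = ∀ y → S y → γ y ≢ just α

      -- Vertices of the colour shifting graph H_{S,γ}: inj₁ x for x ∈ S,
      -- inj₂ α standing for s_α with α ∈ ⋃ x̂ (membership enforced by arcs).
      HVert : Set
      HVert = TElem ⊎ C

      Arc : HVert → HVert → Set
      Arc (inj₁ x) (inj₁ y) = S x × S y × (x ≢ y) × ∃[ c ] (γ x ≡ just c × hat y c)
      Arc (inj₂ α) (inj₁ x) = InHatUnion α × S x × hat x α × NotUsedOnS α
      Arc (inj₁ x) (inj₂ α) = S x × InHatUnion α
      Arc (inj₂ α) (inj₂ β) = InHatUnion α × InHatUnion β × (α ≢ β)

      IsDirectedCycle : List HVert → Set
      IsDirectedCycle [] = ⊥
      IsDirectedCycle (x ∷ []) = ⊥
      IsDirectedCycle (x ∷ y ∷ rest) =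
        Unique (x ∷ y ∷ rest) × Linked Arc ((x ∷ y ∷ rest) ∷ʳ x)

-- Every element x of S on the cycle takes the colour of its predecessor on the
-- cycle: γ(u) if the predecessor is u ∈ S, and α if it is s_α.  The arc into x
-- puts this colour in x̂, so it is allowed at x and clashes with no neighbour
-- outside S.  Inside the clique S, the colours of distinct predecessors are
-- distinct, because γ is proper on S and a colour α with an arc s_α → x is
-- unused on S; the same facts show that the new colour of x differs from the
-- old one and from the colours kept on S off the cycle.
module Submission where

open import Defs
open import Data.Maybe using (Maybe; just; nothing)
open import Data.Maybe.Properties using (just-injective)
open import Data.Sum using (inj₁; inj₂)
open import Data.Sum.Properties using (inj₁-injective)
import Data.Sum.Properties as Sum
open import Data.Product using (_×_; _,_; ∃-syntax; proj₁; proj₂)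
import Data.Product.Properties as Product
open import Data.List using (List; []; _∷_; _∷ʳ_; head)
open import Data.List.Membership.Propositional using (_∈_)
open import Data.List.Membership.Propositional.Properties using (∈-++⁺ˡ; ∈-++⁺ʳ; ∈-++⁻)
open import Data.List.Relation.Unary.Any using (here; there)
open import Data.List.Relation.Unary.All using (lookup)
open import Data.List.Relation.Unary.AllPairs using (_∷_)
open import Data.List.Relation.Unary.Linked using (Linked; [-]; _∷_)
open import Data.List.Relation.Unary.Unique.Propositional using (Unique)
import Data.Bool.Properties as Bool
import Data.Fin.Properties as Fin
open import Data.Empty using (⊥-elim)
open import Relation.Binary.Definitions using (DecidableEquality)
open import Relation.Binary.PropositionalEquality using (_≡_; _≢_; refl; sym; trans; cong; cong₂; subst)
open import Relation.Nullary using (¬_; Dec; yes; no)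
open import Relation.Nullary.Decidable using (map′)
open import Axiom.UniquenessOfIdentityProofs using (module Decidable⇒UIP)

module _ {A : Set} where

  -- The successor is given through head l rather than as an index a ∷ b ∷ l,
  -- so that matching on Consecutive (xs ∷ʳ z) a b needs no split of xs.
  data Consecutive : List A → A → A → Set where
    here  : ∀ {a b l} → head l ≡ just b → Consecutive (a ∷ l) a b
    there : ∀ {c a b l} → Consecutive l a b → Consecutive (c ∷ l) a b

  Linked⇒Consecutive : ∀ {R : A → A → Set} {l a b} → Linked R l → Consecutive l a b → R a b
  Linked⇒Consecutive [-]      (here ())
  Linked⇒Consecutive [-]      (there ())
  Linked⇒Consecutive (r ∷ _)  (here refl) = r
  Linked⇒Consecutive (_ ∷ rs) (there k)   = Linked⇒Consecutive rs k

  Consecutive-∈ʳ : ∀ {c l a b} → Consecutive (c ∷ l) a b → b ∈ l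
  Consecutive-∈ʳ {l = _ ∷ _} (here refl) = here refl
  Consecutive-∈ʳ {l = _ ∷ _} (there k)   = there (Consecutive-∈ʳ k)

  Consecutive-∷ʳ-∈ˡ : ∀ xs {z a b} → Consecutive (xs ∷ʳ z) a b → a ∈ xs
  Consecutive-∷ʳ-∈ˡ []       (here ())
  Consecutive-∷ʳ-∈ˡ []       (there ())
  Consecutive-∷ʳ-∈ˡ (_ ∷ _)  (here _)  = here refl
  Consecutive-∷ʳ-∈ˡ (_ ∷ xs) (there k) = there (Consecutive-∷ʳ-∈ˡ xs k)

  Consecutive-∷ʳ-functional : ∀ {xs z a b b′} → Unique xs →
                              Consecutive (xs ∷ʳ z) a b → Consecutive (xs ∷ʳ z) a b′ → b ≡ b′
  Consecutive-∷ʳ-functional {[]} _ (here ())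
  Consecutive-∷ʳ-functional {[]} _ (there ())
  Consecutive-∷ʳ-functional {_ ∷ _}  _        (here p)  (here q)   = just-injective (trans (sym p) q)
  Consecutive-∷ʳ-functional {_ ∷ xs} (a∉ ∷ _) (here _)  (there k′) = ⊥-elim (lookup a∉ (Consecutive-∷ʳ-∈ˡ xs k′) refl)
  Consecutive-∷ʳ-functional {_ ∷ xs} (a∉ ∷ _) (there k) (here _)   = ⊥-elim (lookup a∉ (Consecutive-∷ʳ-∈ˡ xs k) refl)
  Consecutive-∷ʳ-functional {_ ∷ _}  (_ ∷ uq) (there k) (there k′) = Consecutive-∷ʳ-functional uq k k′

  Consecutive-predecessor : ∀ c {l b} → b ∈ l → ∃[ a ] Consecutive (c ∷ l) a b
  Consecutive-predecessor c (here refl) = c , here refl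
  Consecutive-predecessor c {d ∷ _} (there b∈l) with Consecutive-predecessor d b∈l
  ... | a , k = a , there k

  predecessor? : ∀ {b} → (∀ c → Dec (c ≡ b)) → ∀ l → Dec (∃[ a ] Consecutive l a b)
  predecessor? _≟b []          = no λ ()
  predecessor? _≟b (_ ∷ [])    = no λ { (_ , here ()) ; (_ , there ()) }
  predecessor? {b} _≟b (a ∷ c ∷ l) = extend (c ≟b) (predecessor? _≟b (c ∷ l))
    where
    extend : Dec (c ≡ b) → Dec (∃[ a′ ] Consecutive (c ∷ l) a′ b) → Dec (∃[ a′ ] Consecutive (a ∷ c ∷ l) a′ b)
    extend (yes refl) _ = yes (a , here refl)
    extend (no c≢b)   d = map′ (λ (a′ , k) → a′ , there k) tail d
      where
      tail : ∃[ a′ ] Consecutive (a ∷ c ∷ l) a′ b → ∃[ a′ ] Consecutive (c ∷ l) a′ b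
      tail (_  , here refl) = ⊥-elim (c≢b refl)
      tail (a′ , there k)   = a′ , k

  module _ {x : A} {xs : List A} where

    cycle-predecessor : ∀ {b} → b ∈ x ∷ xs → ∃[ a ] Consecutive (x ∷ xs ∷ʳ x) a b
    cycle-predecessor (here refl) = Consecutive-predecessor x (∈-++⁺ʳ xs (here refl))
    cycle-predecessor (there b∈xs) = Consecutive-predecessor x (∈-++⁺ˡ b∈xs)

    cycle-source-∈ : ∀ {a b} → Consecutive (x ∷ xs ∷ʳ x) a b → a ∈ x ∷ xs
    cycle-source-∈ = Consecutive-∷ʳ-∈ˡ (x ∷ xs)

    cycle-target-∈ : ∀ {a b} → Consecutive (x ∷ xs ∷ʳ x) a b → b ∈ x ∷ xs
    cycle-target-∈ k with ∈-++⁻ xs (Consecutive-∈ʳ k)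
    ... | inj₁ b∈xs        = there b∈xs
    ... | inj₂ (here refl) = here refl

module _ (G : Graph) where

  TAdj-sym : ∀ x y → TAdj G x y → TAdj G y x
  TAdj-sym (inj₁ u) (inj₁ v) uv = trans (Graph.sym G v u) uv
  TAdj-sym (inj₁ u) (inj₂ e) ue = ue
  TAdj-sym (inj₂ e) (inj₁ u) ue = ue
  TAdj-sym (inj₂ e) (inj₂ f) (e≢f , w , we , wf) = (λ f≡e → e≢f (sym f≡e)) , w , wf , we

  TAdj-irrefl : ∀ x → ¬ TAdj G x x
  TAdj-irrefl (inj₁ u) uu = Graph.irrfl G u uu
  TAdj-irrefl (inj₂ e) (e≢e , _) = e≢e refl

  _≟ₑ_ : DecidableEquality (Edge G)
  _≟ₑ_ = Product.≡-dec (Product.≡-dec Fin._≟_ Fin._≟_) λ (p , q) (p′ , q′) →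
    yes (cong₂ _,_ (Fin.<-irrelevant p p′) (Decidable⇒UIP.≡-irrelevant Bool._≟_ q q′))

  _≟ₜ_ : DecidableEquality (TElem G)
  _≟ₜ_ = Sum.≡-dec Fin._≟_ _≟ₑ_

module ShiftAlongCycle
    (G : Graph) {C : Set} (L : ListAssignment G {C}) (γ : PartialColoring G {C})
    (S : TElem G → Set)
    (proper : IsPartialLColoring G L γ)
    (clique : ∀ x y → S x → S y → x ≢ y → TAdj G x y)
    (coloured : ∀ x → S x → ∃[ c ] (γ x ≡ just c))
    (h : HVert G L γ S) (t : List (HVert G L γ S))
    (unique : Unique (h ∷ t))
    (linked : Linked (Arc G L γ S) (h ∷ t ∷ʳ h)) where

  HV : Set
  HV = HVert G L γ S

  _⇢_ : HV → HV → Set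
  a ⇢ b = Consecutive (h ∷ t ∷ʳ h) a b

  ⇢⇒Arc : ∀ {a b} → a ⇢ b → Arc G L γ S a b
  ⇢⇒Arc = Linked⇒Consecutive linked

  Arc-irrefl : ∀ {a} → ¬ Arc G L γ S a a
  Arc-irrefl {inj₁ _} (_ , _ , x≢x , _) = x≢x refl
  Arc-irrefl {inj₂ _} (_ , _ , α≢α)     = α≢α refl

  colour : HV → Maybe C
  colour (inj₁ u) = γ u
  colour (inj₂ α) = just α

  ShiftSource : HV → Set
  ShiftSource (inj₁ u) = S u
  ShiftSource (inj₂ α) = NotUsedOnS G L γ S α

  Arc⇒ShiftSource : ∀ {a x} → Arc G L γ S a (inj₁ x) → ShiftSource a
  Arc⇒ShiftSource {inj₁ _} (su , _) = su
  Arc⇒ShiftSource {inj₂ _} (_ , _ , _ , unused) = unused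

  Arc⇒hat : ∀ {a x} → Arc G L γ S a (inj₁ x) → S x × ∃[ c ] (colour a ≡ just c × hat G L γ S x c)
  Arc⇒hat {inj₁ _} (_ , sx , _ , c , γu≡c , x̂c) = sx , c , γu≡c , x̂c
  Arc⇒hat {inj₂ α} (_ , sx , x̂α , _)           = sx , α , refl , x̂α

  ShiftSource-colour-unused : ∀ {a z c} → ShiftSource a → S z → a ≢ inj₁ z →
                              colour a ≡ just c → γ z ≢ just c
  ShiftSource-colour-unused {inj₁ u} {z} {c} su sz u≢z =
    proj₂ proper u z c (clique u z su sz λ u≡z → u≢z (cong inj₁ u≡z))
  ShiftSource-colour-unused {inj₂ α} {z} unused sz _ refl = unused z sz

  ShiftSource-colour-injective : ∀ {a b c} → ShiftSource a → ShiftSource b → a ≢ b →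
                                 colour a ≡ just c → colour b ≢ just c
  ShiftSource-colour-injective {a} {inj₁ v} sa sv a≢b ca = ShiftSource-colour-unused sa sv a≢b ca
  ShiftSource-colour-injective {inj₁ u} {inj₂ β} su sβ a≢b cu cβ =
    ShiftSource-colour-unused sβ su (λ b≡a → a≢b (sym b≡a)) cβ cu
  ShiftSource-colour-injective {inj₂ α} {inj₂ β} _ _ a≢b refl β≡α =
    a≢b (cong inj₂ (sym (just-injective β≡α)))

  Shifted : TElem G → Set
  Shifted x = ∃[ a ] a ⇢ inj₁ x

  shifted? : ∀ x → Dec (Shifted x)
  shifted? x = predecessor? is-x (h ∷ t ∷ʳ h)
    where
    is-x : ∀ b → Dec (b ≡ inj₁ x)
    is-x (inj₁ z) = map′ (cong inj₁) inj₁-injective (_≟ₜ_ G z x)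
    is-x (inj₂ _) = no λ ()

  Shifted⇒onCycle : ∀ {x} → Shifted x → S x × inj₁ x ∈ h ∷ t
  Shifted⇒onCycle (a , k) = proj₁ (Arc⇒hat (⇢⇒Arc k)) , cycle-target-∈ k

  onCycle⇒Shifted : ∀ {x} → inj₁ x ∈ h ∷ t → Shifted x
  onCycle⇒Shifted = cycle-predecessor

  recolour : ∀ x → Dec (Shifted x) → Maybe C
  recolour x (yes (a , _)) = colour a
  recolour x (no _)        = γ x

  γ′ : PartialColoring G {C}
  γ′ x = recolour x (shifted? x)

  γ′-respects-L : ∀ x c → γ′ x ≡ just c → L x c
  γ′-respects-L x c γ′x≡c with shifted? x
  ... | no _ = proj₁ proper x c γ′x≡c
  ... | yes (a , k) with Arc⇒hat (⇢⇒Arc k)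
  ...   | _ , c′ , ca≡c′ , x̂c′ = subst (L x) (just-injective (trans (sym ca≡c′) γ′x≡c)) (proj₁ x̂c′)

  shifted-vs-kept : ∀ {a x z c} → a ⇢ inj₁ x → ¬ Shifted z → TAdj G x z →
                    colour a ≡ just c → γ z ≢ just c
  shifted-vs-kept {a} {x} {z} {c} k z-kept xz ca≡c γz≡c =
    proj₂ x̂c z xz z∉S γz≡c
    where
    arc : Arc G L γ S a (inj₁ x)
    arc = ⇢⇒Arc k
    x̂c : hat G L γ S x c
    x̂c with Arc⇒hat arc
    ... | _ , c′ , ca≡c′ , x̂c′ = subst (hat G L γ S x) (just-injective (trans (sym ca≡c′) ca≡c)) x̂c′
    a≢z : a ≢ inj₁ z
    a≢z refl = z-kept (onCycle⇒Shifted (cycle-source-∈ k))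
    z∉S : ¬ S z
    z∉S sz = ShiftSource-colour-unused (Arc⇒ShiftSource arc) sz a≢z ca≡c γz≡c

  shifted-vs-shifted : ∀ {a b x z c} → a ⇢ inj₁ x → b ⇢ inj₁ z → x ≢ z →
                       colour a ≡ just c → colour b ≢ just c
  shifted-vs-shifted {a} {b} k k′ x≢z =
    ShiftSource-colour-injective (Arc⇒ShiftSource (⇢⇒Arc k))
                                 (Arc⇒ShiftSource (⇢⇒Arc k′)) a≢b
    where
    a≢b : a ≢ b
    a≢b refl = x≢z (inj₁-injective (Consecutive-∷ʳ-functional unique k k′))

  γ′-proper : ∀ x z c → TAdj G x z → γ′ x ≡ just c → γ′ z ≢ just c
  γ′-proper x z c xz with shifted? x | shifted? z
  ... | no _        | no _         = proj₂ proper x z c xz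
  ... | yes (_ , k) | no z-kept    = shifted-vs-kept k z-kept xz
  ... | no x-kept   | yes (_ , k′) = λ γx≡c γ′z≡c → shifted-vs-kept k′ x-kept (TAdj-sym G x z xz) γ′z≡c γx≡c
  ... | yes (_ , k) | yes (_ , k′) = shifted-vs-shifted k k′ λ { refl → TAdj-irrefl G x xz }

  γ′-domain : ∀ x → (γ x ≡ nothing → γ′ x ≡ nothing) × (γ′ x ≡ nothing → γ x ≡ nothing)
  γ′-domain x with shifted? x
  ... | no _ = (λ eq → eq) , (λ eq → eq)
  ... | yes (a , k) with Arc⇒hat (⇢⇒Arc k)
  ...   | sx , _ , ca≡c , _ with coloured x sx
  ...     | _ , γx≡d rewrite γx≡d | ca≡c = (λ ()) , (λ ())

  γ′-changes : ∀ x → S x → inj₁ x ∈ h ∷ t → γ′ x ≢ γ x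
  γ′-changes x sx x∈cycle with shifted? x
  ... | no x-kept   = ⊥-elim (x-kept (onCycle⇒Shifted x∈cycle))
  ... | yes (a , k) with coloured x sx
  ...   | d , γx≡d = λ ca≡γx →
    ShiftSource-colour-unused (Arc⇒ShiftSource (⇢⇒Arc k)) sx a≢x (trans ca≡γx γx≡d) γx≡d
    where
    a≢x : a ≢ inj₁ x
    a≢x refl = Arc-irrefl {inj₁ x} (⇢⇒Arc k)

  γ′-keeps : ∀ x → ¬ (S x × inj₁ x ∈ h ∷ t) → γ x ≢ nothing → γ′ x ≡ γ x
  γ′-keeps x off _ with shifted? x
  ... | no _          = refl
  ... | yes x-shifted = ⊥-elim (off (Shifted⇒onCycle x-shifted))

lemma1 : (G : Graph) {C : Set} (L : ListAssignment G {C}) (γ : PartialColoring G {C})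
         (S : TElem G → Set) →
         IsPartialLColoring G L γ →
         (∀ x y → S x → S y → x ≢ y → TAdj G x y) →
         (∀ x → S x → ∃[ c ] (γ x ≡ just c)) →
         (cyc : List (HVert G L γ S)) →
         IsDirectedCycle G L γ S cyc →
         ∃[ γ′ ] (IsPartialLColoring G L γ′ ×
                  (∀ x → (γ x ≡ nothing → γ′ x ≡ nothing) × (γ′ x ≡ nothing → γ x ≡ nothing)) ×
                  (∀ x → S x → inj₁ x ∈ cyc → γ′ x ≢ γ x) ×
                  (∀ x → ¬ (S x × inj₁ x ∈ cyc) → γ x ≢ nothing → γ′ x ≡ γ x))
lemma1 G L γ S proper clique coloured []          ()
lemma1 G L γ S proper clique coloured (_ ∷ [])    ()
lemma1 G L γ S proper clique coloured (h ∷ t@(_ ∷ _)) (unique , linked) =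
  γ′ , (γ′-respects-L , γ′-proper) , γ′-domain , γ′-changes , γ′-keeps
  where open ShiftAlongCycle G L γ S proper clique coloured h t unique linked
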